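{- Let $z,z'\in\hat K$, with continued fraction algorithm data $(f_0,z_0),(f_1,z_1),\dots$ for $z$ and $(g_0,z'_0),(g_1,z'_1),\dots$ for $z'$. Let $m\ge0$ be such that $z_m$ is defined and $\nu(z-z')>2\sum_{i=1}^m\mathtt{deg}(f_i)$. Then $z'_m$ is defined and $f_i=g_i$ for all $i\le m$.
   Context: Let $E$ be a field. For $n\ge1$ let $K_n=E((t^{ -1/n}))$ with valuation $\nu\big(\sum_{i\ge -N}a_it^{ -i/n}\big)=N/n$ when $a_{ -N}\ne0$, $\nu(0)=\infty$; $\tilde{K}=\bigcup_nK_n$, $\hat{K}$ its completion. $\bar{A}=\bigcup_nE[t^{1/n}]$, $\mathtt{deg}(f)=-\nu(f)$. For every $w\in\hat{K}$ there is a unique $f\in\bar{A}$ with $\nu(w-f)>0$. Continued fraction algorithm for $z\in\hat K$: $z_0=z$; given $z_n$, $f_n\in\bar A$ is the unique element with $\nu(z_n-f_n)>0$; if $z_n=f_n$ the algorithm ends and $z_{n+1}$ is not defined; otherwise $z_{n+1}=1/(z_n-f_n)$. -}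

module Defs where

open import Level using (Level; _⊔_)
open import Algebra.Bundles using (CommutativeRing)
import Algebra.Properties.Ring as RingProps
open import Data.Nat as ℕ using (ℕ; zero; suc)
open import Data.Rational as ℚ using (ℚ; 0ℚ; _≤_; _<_; _≤?_; _≟_; _⊓_)
open import Data.Rational.Properties using (<-≤-trans; p⊓q≤p; p⊓q≤q)
open import Data.List using (List; []; _∷_; _++_; deduplicate; foldr)
open import Data.List.Membership.Propositional using (_∈_; _∉_)
open import Data.List.Membership.Propositional.Properties using (∈-++⁺ˡ; ∈-++⁺ʳ)
open import Data.Product using (Σ; _×_; _,_)
open import Relation.Nullary using (¬_; yes; no)

record Field (c ℓ : Level) : Set (Level.suc (c ⊔ ℓ)) where
  field
    commutativeRing : CommutativeRing c ℓ
  open CommutativeRing commutativeRing public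
  field
    0≉1  : ¬ (0# ≈ 1#)
    inv  : ∀ x → ¬ (x ≈ 0#) → Σ Carrier λ y → x * y ≈ 1#

module Puiseux {c ℓ : Level} (E : Field c ℓ) where
  open Field E
  open RingProps ring using (-0#≈0#)

  -- An element  w = Σ_{q ∈ ℚ} a_q t^{-q}  of K̂, where ν(t^{-q}) = q.
  -- The elements of K̂ are exactly the formal series whose support is
  -- bounded below and has only finitely many points below any bound B
  -- (these are the limits of their truncations, which lie in ⋃ₙ Kₙ).
  record Ser : Set (c ⊔ ℓ) where
    field
      coeff     : ℚ → Carrier
      low       : ℚ
      below-low : ∀ q → q < low → coeff q ≈ 0#
      supp      : ℚ → List ℚ
      supp-ok   : ∀ B q → q ≤ B → q ∉ supp B → coeff q ≈ 0#
  open Ser public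

  _≋_ : Ser → Ser → Set ℓ
  x ≋ y = ∀ q → coeff x q ≈ coeff y q

  ν>[_]_ : Ser → ℚ → Set ℓ
  ν>[ w ] b = ∀ q → q ≤ b → coeff w q ≈ 0#

  private
    zero-sub : ∀ {a b} → a ≈ 0# → b ≈ 0# → a - b ≈ 0#
    zero-sub {a} {b} p r =
      trans (+-cong p (trans (-‿cong r) -0#≈0#)) (+-identityˡ 0#)

  _⊖_ : Ser → Ser → Ser
  x ⊖ y = record
    { coeff     = λ q → coeff x q - coeff y q
    ; low       = low x ⊓ low y
    ; below-low = λ q q< → zero-sub
        (below-low x q (<-≤-trans q< (p⊓q≤p (low x) (low y))))
        (below-low y q (<-≤-trans q< (p⊓q≤q (low x) (low y))))
    ; supp      = λ B → supp x B ++ supp y B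
    ; supp-ok   = λ B q q≤ q∉ → zero-sub
        (supp-ok x B q q≤ (λ m → q∉ (∈-++⁺ˡ m)))
        (supp-ok y B q q≤ (λ m → q∉ (∈-++⁺ʳ (supp x B) m)))
    }

  -- polar part: the unique f ∈ Ā with ν(w - f) > 0, i.e. the truncation
  -- of w to the exponents q ≤ 0 (terms a_q t^{-q}, -q ≥ 0).
  polar : Ser → Ser
  polar x = record
    { coeff     = cf
    ; low       = low x
    ; below-low = bl
    ; supp      = supp x
    ; supp-ok   = so
    }
    where
      cf : ℚ → Carrier
      cf q with q ≤? 0ℚ
      ... | yes _ = coeff x q
      ... | no  _ = 0#
      bl : ∀ q → q < low x → cf q ≈ 0#
      bl q q< with q ≤? 0ℚ
      ... | yes _ = below-low x q q<
      ... | no  _ = refl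
      so : ∀ B q → q ≤ B → q ∉ supp x B → cf q ≈ 0#
      so B q q≤ q∉ with q ≤? 0ℚ
      ... | yes _ = supp-ok x B q q≤ q∉
      ... | no  _ = refl

  -- coefficient of t^{-q} in the product x·y  (a finite sum, since
  -- a_r b_{q-r} ≠ 0 forces r ≤ q - low y and r ∈ supp x (q - low y))
  mulCoeff : Ser → Ser → ℚ → Carrier
  mulCoeff x y q =
    foldr (λ r acc → coeff x r * coeff y (q ℚ.- r) + acc) 0#
          (deduplicate _≟_ (supp x (q ℚ.- low y)))

  oneCoeff : ℚ → Carrier
  oneCoeff q with q ≟ 0ℚ
  ... | yes _ = 1#
  ... | no  _ = 0#

  _·_≋1 : Ser → Ser → Set ℓ
  x · y ≋1 = ∀ q → mulCoeff x y q ≈ oneCoeff q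

  -- Continued fraction data of z up to stage m, with z_m defined:
  -- z_0 = z, f_i = polar z_i, and z_{i+1} = 1/(z_i - f_i) for i < m
  -- (z_{i+1} exists iff z_i ≠ f_i, i.e. iff z_i - f_i is invertible).
  record CFUpTo (z : Ser) (m : ℕ) : Set (c ⊔ ℓ) where
    field
      zs    : ℕ → Ser
      start : zs 0 ≋ z
      step  : ∀ i → i ℕ.< m → zs (suc i) · (zs i ⊖ polar (zs i)) ≋1
  open CFUpTo public

  fq : ∀ {z m} → CFUpTo z m → ℕ → Ser
  fq d i = polar (zs d i)

  -- deg(f) = d, i.e. ν(f) = -d
  IsDeg : Ser → ℚ → Set ℓ
  IsDeg f d = ¬ (coeff f (ℚ.- d) ≈ 0#) × (∀ q → q < ℚ.- d → coeff f q ≈ 0#)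

  sum1to : (ℕ → ℚ) → ℕ → ℚ
  sum1to ds zero    = 0ℚ
  sum1to ds (suc m) = sum1to ds m ℚ.+ ds (suc m)

-- Write X_i = z_i − f_i, so that z_(i+1) X_i = 1. As deg f_(i+1) = d_(i+1) ≥ 0,
-- the series z_(i+1) has valuation −d_(i+1) and X_i has valuation d_(i+1).
-- If ν(z_i − z′_i) > C then ν(X_i − X′_i) > C, because subtracting the polar
-- part only changes exponents ≤ 0 ≤ C. For C ≥ d_(i+1) the series X′_i then
-- also has valuation d_(i+1), so it is invertible, and
-- 1/X_i − 1/X′_i = (X′_i − X_i)/(X_i X′_i) has valuation > C − 2 d_(i+1).
-- Starting from C = 2 Σ_(1≤i≤m) d_i this keeps ν(z_i − z′_i) > 2 Σ_(j>i) d_j ≥ 0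
-- for all i ≤ m, so the polar parts agree and z′ can be expanded m times.
-- The inverse of a series of valuation v is built coefficientwise: the
-- coefficient at t^−p is determined by those at t^−s for s ≤ p − ε, where ε
-- is the least gap above v among the finitely many relevant exponents of x.

module Submission where

open import Defs
open import Level using (Level)
open import Function using (_∘_; id)
open import Data.Empty using (⊥-elim)
open import Data.Product using (Σ; _×_; _,_; proj₁; proj₂; ∃-syntax)
open import Data.Nat as ℕ using (ℕ; zero; suc; z≤n; s≤s)
import Data.Nat.Properties as ℕₚ
open import Data.Rational as ℚ using (ℚ; mkℚ; 0ℚ; 1ℚ)
import Data.Rational.Properties as ℚₚ
open import Data.Rational.Solver using (module +-*-Solver)
open import Data.List using (List; []; _∷_; map; filter; foldr; deduplicate; cartesianProductWith)
open import Data.List.Properties using (filter-all)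
open import Data.List.Membership.Propositional using (_∈_; _∉_)
open import Data.List.Membership.Propositional.Properties
  using (∈-filter⁺; ∈-filter⁻; ∈-map⁺; ∈-++⁺ˡ; ∈-++⁺ʳ; ∈-deduplicate⁺; ∈-cartesianProductWith⁺)
import Data.List.Relation.Unary.All.Properties as All
open import Relation.Binary.Bundles using (DecTotalOrder)
open import Data.List.Extrema (DecTotalOrder.totalOrder ℚₚ.≤-decTotalOrder) using (min; argmin-all; min≤xs)
import Data.List.Membership.DecPropositional as DecMembership
open import Data.List.Relation.Unary.Any using (here; there)
open import Data.List.Relation.Unary.All as All using (All)
open import Data.List.Relation.Unary.AllPairs using ([]; _∷_)
open import Data.List.Relation.Unary.Unique.DecPropositional.Properties ℚ._≟_ using (deduplicate-!)
open import Data.List.Relation.Unary.Unique.Propositional using (Unique)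
import Data.List.Relation.Unary.Unique.Propositional.Properties as Unique
open import Algebra.Bundles using (CommutativeRing)
import Algebra.Properties.Ring as RingProperties
import Algebra.Properties.CommutativeSemigroup as CommutativeSemigroupProperties
open import Relation.Binary.Definitions using (DecidableEquality; tri<; tri≈; tri>)
open import Relation.Binary.PropositionalEquality as ≡ using (_≡_; _≢_)
open import Relation.Nullary using (¬_; Dec; yes; no; ¬?)
open import Relation.Nullary.Decidable using (decidable-stable)

module ℚ-Arithmetic where
  open import Data.Integer as ℤ using (+_)
  import Data.Integer.Properties as ℤₚ
  open import Data.Rational.Unnormalised as ℚᵘ using (mkℚᵘ; *<*; *≡*)
  import Data.Rational.Unnormalised.Properties as ℚᵘₚ
  open import Data.Rational using (_+_; _-_; -_; _*_; _≤_; _<_)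
  open ≡ using (refl; sym; trans; cong; subst; subst₂)
  open +-*-Solver using (solve; _:=_; _:+_; _:-_; :-_; con)

  _⋆_ : ℕ → ℚ → ℚ
  zero  ⋆ e = 0ℚ
  suc n ⋆ e = e + n ⋆ e

  private
    n⋆1ℚ≃n : ∀ n → ℚ.toℚᵘ (n ⋆ 1ℚ) ℚᵘ.≃ mkℚᵘ (+ n) 0
    n⋆1ℚ≃n zero    = *≡* refl
    n⋆1ℚ≃n (suc n) = ℚᵘₚ.≃-trans (ℚₚ.toℚᵘ-homo-+ 1ℚ (n ⋆ 1ℚ))
      (ℚᵘₚ.≃-trans (ℚᵘₚ.+-congʳ (ℚ.toℚᵘ 1ℚ) (n⋆1ℚ≃n n)) (*≡* (cong (ℤ._* + 1) 1+n≡)))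
      where
      1+n≡ : + 1 ℤ.* + 1 ℤ.+ + n ℤ.* + 1 ≡ + suc n
      1+n≡ = cong (ℤ._+_ (+ 1)) (ℤₚ.*-identityʳ (+ n))

    ⋆-distrib-* : ∀ n e → n ⋆ e ≡ (n ⋆ 1ℚ) * e
    ⋆-distrib-* zero    e = sym (ℚₚ.*-zeroˡ e)
    ⋆-distrib-* (suc n) e = begin
      e + n ⋆ e                  ≡⟨ ≡.cong₂ _+_ (sym (ℚₚ.*-identityˡ e)) (⋆-distrib-* n e) ⟩
      1ℚ * e + (n ⋆ 1ℚ) * e      ≡⟨ sym (ℚₚ.*-distribʳ-+ e 1ℚ (n ⋆ 1ℚ)) ⟩
      (1ℚ + n ⋆ 1ℚ) * e          ∎
      where
      open ≡.≡-Reasoning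

    i≤+∣i∣ : ∀ i → i ℤ.≤ + ℤ.∣ i ∣
    i≤+∣i∣ (+ _)      = ℤₚ.≤-refl
    i≤+∣i∣ ℤ.-[1+ _ ] = ℤ.-≤+

    p<1+∣↥p∣ : ∀ p → p < suc ℤ.∣ ℚ.↥ p ∣ ⋆ 1ℚ
    p<1+∣↥p∣ p@(mkℚ n d-1 _) = ℚₚ.toℚᵘ-cancel-<
      (ℚᵘₚ.<-respʳ-≃ (ℚᵘₚ.≃-sym (n⋆1ℚ≃n (suc ℤ.∣ n ∣))) (*<* n<))
      where
      n< : n ℤ.* + 1 ℤ.< + suc ℤ.∣ n ∣ ℤ.* + suc d-1
      n< rewrite ℤₚ.*-identityʳ n =
        ℤₚ.≤-<-trans (i≤+∣i∣ n) (ℤₚ.<-≤-trans (ℤ.+<+ (ℕₚ.n<1+n ℤ.∣ n ∣))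
          (ℤ.+≤+ (ℕₚ.m≤m*n (suc ℤ.∣ n ∣) (suc d-1))))

  archimedean : ∀ p e → 0ℚ < e → ∃[ n ] p < n ⋆ e
  archimedean p e 0<e = n , subst₂ _<_ p/e*e≡p (sym (⋆-distrib-* n e)) (ℚₚ.*-monoˡ-<-pos e p/e<n)
    where
    instance
      e-pos : ℚ.Positive e
      e-pos = ℚ.positive 0<e
      e-nonZero : ℚ.NonZero e
      e-nonZero = ℚₚ.pos⇒nonZero e
    n = suc ℤ.∣ ℚ.↥ (p ℚ.÷ e) ∣
    p/e<n = p<1+∣↥p∣ (p ℚ.÷ e)
    p/e*e≡p : (p ℚ.÷ e) * e ≡ p
    p/e*e≡p = trans (ℚₚ.*-assoc p (ℚ.1/ e) e)
      (trans (cong (p *_) (ℚₚ.*-inverseˡ e)) (ℚₚ.*-identityʳ p))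

  p-q+q≡p : ∀ p q → (p - q) + q ≡ p
  p-q+q≡p = solve 2 (λ p q → (p :- q) :+ q := p) refl

  private
    <⇒-<0 : ∀ {p q} → p < q → p - q < 0ℚ
    <⇒-<0 {p} {q} p<q = subst (p - q <_) (ℚₚ.+-inverseʳ q) (ℚₚ.+-monoˡ-< (- q) p<q)

    ≤⇒-≤0 : ∀ {p q} → p ≤ q → p - q ≤ 0ℚ
    ≤⇒-≤0 {p} {q} p≤q = subst (p - q ≤_) (ℚₚ.+-inverseʳ q) (ℚₚ.+-monoˡ-≤ (- q) p≤q)

    -<0⇒< : ∀ {p q} → p - q < 0ℚ → p < q
    -<0⇒< {p} {q} h = subst₂ _<_ (p-q+q≡p p q) (ℚₚ.+-identityˡ q) (ℚₚ.+-monoˡ-< q h)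

    -≤0⇒≤ : ∀ {p q} → p - q ≤ 0ℚ → p ≤ q
    -≤0⇒≤ {p} {q} h = subst₂ _≤_ (p-q+q≡p p q) (ℚₚ.+-identityˡ q) (ℚₚ.+-monoˡ-≤ q h)

  <-by-difference : ∀ {p q r s} → p < q → r - s ≡ p - q → r < s
  <-by-difference p<q e = -<0⇒< (subst (_< 0ℚ) (sym e) (<⇒-<0 p<q))

  ≤-by-difference : ∀ {p q r s} → p ≤ q → r - s ≡ p - q → r ≤ s
  ≤-by-difference p≤q e = -≤0⇒≤ (subst (_≤ 0ℚ) (sym e) (≤⇒-≤0 p≤q))

  countBelow : ℚ → List ℚ → ℕ
  countBelow p []       = 0
  countBelow p (r ∷ rs) with r ℚ.<? p
  ... | yes _ = suc (countBelow p rs)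
  ... | no _  = countBelow p rs

  countBelow-mono : ∀ {s p} rs → s < p → countBelow s rs ℕ.≤ countBelow p rs
  countBelow-mono []       s<p = z≤n
  countBelow-mono {s} {p} (r ∷ rs) s<p with r ℚ.<? s | r ℚ.<? p
  ... | yes _   | yes _   = s≤s (countBelow-mono rs s<p)
  ... | yes r<s | no r≮p  = ⊥-elim (r≮p (ℚₚ.<-trans r<s s<p))
  ... | no _    | yes _   = ℕₚ.m≤n⇒m≤1+n (countBelow-mono rs s<p)
  ... | no _    | no _    = countBelow-mono rs s<p

  countBelow-< : ∀ {s p rs} → s ∈ rs → s < p → countBelow s rs ℕ.< countBelow p rs
  countBelow-< {s} {p} {r ∷ rs} s∈ s<p with r ℚ.<? s | r ℚ.<? p | s∈
  ... | yes r<s | _       | here ≡.refl = ⊥-elim (ℚₚ.<-irrefl ≡.refl r<s)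
  ... | no _    | yes _   | here ≡.refl = s≤s (countBelow-mono rs s<p)
  ... | _       | no r≮p  | here ≡.refl = ⊥-elim (r≮p s<p)
  ... | yes _   | yes _   | there s∈rs = s≤s (countBelow-< s∈rs s<p)
  ... | yes r<s | no r≮p  | there _    = ⊥-elim (r≮p (ℚₚ.<-trans r<s s<p))
  ... | no _    | yes _   | there s∈rs = ℕₚ.m≤n⇒m≤1+n (countBelow-< s∈rs s<p)
  ... | no _    | no _    | there s∈rs = countBelow-< s∈rs s<p

  p-[p-q]≡q : ∀ p q → p - (p - q) ≡ q
  p-[p-q]≡q = solve 2 (λ p q → p :- (p :- q) := q) refl

  p-q≡p-r⇒q≡r : ∀ p {q r} → p - q ≡ p - r → q ≡ r
  p-q≡p-r⇒q≡r p {q} {r} e = trans (sym (p-[p-q]≡q p q)) (trans (cong (_-_ p) e) (p-[p-q]≡q p r))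

  p+q-p≡q : ∀ p q → (p + q) - p ≡ q
  p+q-p≡q = solve 2 (λ p q → (p :+ q) :- p := q) refl

  p<r⇒p+q-r<q : ∀ {p q r} → p < r → (p + q) - r < q
  p<r⇒p+q-r<q {p} {q} {r} h = <-by-difference h (solve 3 (λ p q r → ((p :+ q) :- r) :- q := p :- r) refl p q r)

  p<-q⇒p+q<0 : ∀ {p q} → p < - q → p + q < 0ℚ
  p<-q⇒p+q<0 {p} {q} h = <-by-difference h (solve 2 (λ p q → (p :+ q) :- con 0ℚ := p :- (:- q)) refl p q)

  neg-involutive : ∀ p → - (- p) ≡ p
  neg-involutive = solve 1 (λ p → :- (:- p) := p) refl

  0-[-p]≡p : ∀ p → 0ℚ - (- p) ≡ p
  0-[-p]≡p = solve 1 (λ p → con 0ℚ :- (:- p) := p) refl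

  -p<q⇒0-q<p : ∀ {p q} → - p < q → 0ℚ - q < p
  -p<q⇒0-q<p {p} {q} h = <-by-difference h (solve 2 (λ p q → (con 0ℚ :- q) :- p := (:- p) :- q) refl p q)

  p≤[r-q]-q⇒-q≤s⇒p+q-s≤r : ∀ {p q r s} → p ≤ (r - q) - q → - q ≤ s → (p + q) - s ≤ r
  p≤[r-q]-q⇒-q≤s⇒p+q-s≤r {p} {q} {r} {s} p≤ -q≤s = ≤-by-difference (ℚₚ.+-mono-≤ p≤ -q≤s)
    (solve 4 (λ p q r s → ((p :+ q) :- s) :- r := (p :+ (:- q)) :- (((r :- q) :- q) :+ s)) refl p q r s)

  p+q≡0⇒p≡-q : ∀ {p q} → p + q ≡ 0ℚ → p ≡ - q
  p+q≡0⇒p≡-q {p} {q} e = begin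
    p              ≡⟨ solve 2 (λ p q → p := (p :+ q) :- q) refl p q ⟩
    (p + q) - q    ≡⟨ cong (_- q) e ⟩
    0ℚ - q         ≡⟨ ℚₚ.+-identityˡ (- q) ⟩
    - q            ∎
    where
    open ≡.≡-Reasoning

  p+q-r+[r-q]≡p : ∀ p q r → ((p + q) - r) + (r - q) ≡ p
  p+q-r+[r-q]≡p = solve 3 (λ p q r → ((p :+ q) :- r) :+ (r :- q) := p) refl

  p<q⇒0<q-p : ∀ {p q} → p < q → 0ℚ < q - p
  p<q⇒0<q-p {p} {q} h = <-by-difference h (solve 2 (λ p q → con 0ℚ :- (q :- p) := p :- q) refl p q)

  p+q<0⇒p<-q : ∀ {p q} → p + q < 0ℚ → p < - q
  p+q<0⇒p<-q {p} {q} h = <-by-difference h (solve 2 (λ p q → p :- (:- q) := (p :+ q) :- con 0ℚ) refl p q)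

  -q≤p-r⇒r≤p+q : ∀ {p q r} → - q ≤ p - r → r ≤ p + q
  -q≤p-r⇒r≤p+q {p} {q} {r} h = ≤-by-difference h (solve 3 (λ p q r → r :- (p :+ q) := (:- q) :- (p :- r)) refl p q r)

  e≤r-q⇒p<e+n⇒p-r+q<n : ∀ {p q r e n} → e ≤ r - q → p < e + n → (p - r) + q < n
  e≤r-q⇒p<e+n⇒p-r+q<n {p} {q} {r} {e} {n} e≤ p< = <-by-difference (ℚₚ.+-mono-<-≤ p< e≤)
    (solve 5 (λ p q r e n → ((p :- r) :+ q) :- n := (p :+ e) :- ((e :+ n) :+ (r :- q))) refl p q r e n)

  q<r⇒p+q-r+q+q≤p+q+q : ∀ {p q r} → q < r → (((p + q) - r) + q) + q ≤ (p + q) + q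
  q<r⇒p+q-r+q+q≤p+q+q {p} {q} {r} h = ℚₚ.<⇒≤ (<-by-difference h
    (solve 3 (λ p q r → ((((p :+ q) :- r) :+ q) :+ q) :- ((p :+ q) :+ q) := q :- r) refl p q r))

  p<0⇒q≤r⇒p-r<-q : ∀ {p q r} → p < 0ℚ → q ≤ r → p - r < - q
  p<0⇒q≤r⇒p-r<-q {p} {q} {r} p<0 q≤r = <-by-difference (ℚₚ.+-mono-<-≤ p<0 q≤r)
    (solve 3 (λ p q r → (p :- r) :- (:- q) := (p :+ q) :- (con 0ℚ :+ r)) refl p q r)

  0≤p⇒-q≤p-q : ∀ {p q} → 0ℚ ≤ p → - q ≤ p - q
  0≤p⇒-q≤p-q {p} {q} h = ≤-by-difference h (solve 2 (λ p q → (:- q) :- (p :- q) := con 0ℚ :- p) refl p q)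

  0≤q⇒p≤p+q : ∀ {p q} → 0ℚ ≤ q → p ≤ p + q
  0≤q⇒p≤p+q {p} {q} h = ≤-by-difference h (solve 2 (λ p q → p :- (p :+ q) := con 0ℚ :- q) refl p q)

  -p≤0⇒0≤p : ∀ {p} → - p ≤ 0ℚ → 0ℚ ≤ p
  -p≤0⇒0≤p {p} h = ≤-by-difference h (solve 1 (λ p → con 0ℚ :- p := (:- p) :- con 0ℚ) refl p)

  p≤q⇒0≤[q-p]+[q-p] : ∀ {p q} → p ≤ q → 0ℚ ≤ (q - p) + (q - p)
  p≤q⇒0≤[q-p]+[q-p] {p} {q} h = ≤-by-difference (ℚₚ.+-mono-≤ h h)
    (solve 2 (λ p q → con 0ℚ :- ((q :- p) :+ (q :- p)) := (p :+ p) :- (q :+ q)) refl p q)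

  [r-[p+q]]+[r-[p+q]]≡[r-p]+[r-p]-q-q : ∀ p q r → (r - (p + q)) + (r - (p + q)) ≡ (((r - p) + (r - p)) - q) - q
  [r-[p+q]]+[r-[p+q]]≡[r-p]+[r-p]-q-q = solve 3 (λ p q r →
    (r :- (p :+ q)) :+ (r :- (p :+ q)) := (((r :- p) :+ (r :- p)) :- q) :- q) refl

  0≤[p-q]-q⇒0≤q⇒q≤p : ∀ {p q} → 0ℚ ≤ (p - q) - q → 0ℚ ≤ q → q ≤ p
  0≤[p-q]-q⇒0≤q⇒q≤p {p} {q} h₁ h₂ = ≤-by-difference (ℚₚ.+-mono-≤ h₁ h₂)
    (solve 2 (λ p q → q :- p := (con 0ℚ :+ con 0ℚ) :- (((p :- q) :- q) :+ q)) refl p q)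

  p-q<r⇒p-r<q : ∀ {p q r} → p - q < r → p - r < q
  p-q<r⇒p-r<q {p} {q} {r} h = <-by-difference h (solve 3 (λ p q r → (p :- r) :- q := (p :- q) :- r) refl p q r)

module ListSum {c ℓ : Level} (R : CommutativeRing c ℓ) {A : Set} (_≟_ : DecidableEquality A) where
  open CommutativeRing R
  open RingProperties ring using (-0#≈0#; -‿+-comm)
  open CommutativeSemigroupProperties +-commutativeSemigroup using (x∙yz≈y∙xz; interchange)
  open DecMembership _≟_ using (_∈?_)

  sumL : List A → (A → Carrier) → Carrier
  sumL xs f = foldr (λ x acc → f x + acc) 0# xs

  remove : A → List A → List A
  remove x = filter (λ y → ¬? (y ≟ x))

  sumL-cong : ∀ xs {f g} → (∀ {x} → x ∈ xs → f x ≈ g x) → sumL xs f ≈ sumL xs g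
  sumL-cong []       f≈g = refl
  sumL-cong (x ∷ xs) f≈g = +-cong (f≈g (here ≡.refl)) (sumL-cong xs (f≈g ∘ there))

  sumL-zero : ∀ xs {f} → (∀ {x} → x ∈ xs → f x ≈ 0#) → sumL xs f ≈ 0#
  sumL-zero []       f≈0 = refl
  sumL-zero (x ∷ xs) f≈0 = trans (+-cong (f≈0 (here ≡.refl)) (sumL-zero xs (f≈0 ∘ there))) (+-identityˡ 0#)

  sumL-+ : ∀ xs f g → sumL xs (λ x → f x + g x) ≈ sumL xs f + sumL xs g
  sumL-+ []       f g = sym (+-identityˡ 0#)
  sumL-+ (x ∷ xs) f g = trans (+-congˡ (sumL-+ xs f g)) (interchange (f x) (g x) (sumL xs f) (sumL xs g))

  sumL-neg : ∀ xs f → sumL xs (λ x → - f x) ≈ - sumL xs f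
  sumL-neg []       f = sym -0#≈0#
  sumL-neg (x ∷ xs) f = trans (+-congˡ (sumL-neg xs f)) (-‿+-comm (f x) (sumL xs f))

  sumL-minus : ∀ xs f g → sumL xs (λ x → f x - g x) ≈ sumL xs f - sumL xs g
  sumL-minus xs f g = trans (sumL-+ xs f (λ x → - g x)) (+-congˡ (sumL-neg xs g))

  sumL-map : ∀ h xs f → sumL (map h xs) f ≡ sumL xs (f ∘ h)
  sumL-map h []       f = ≡.refl
  sumL-map h (x ∷ xs) f = ≡.cong (f (h x) +_) (sumL-map h xs f)

  sumL-remove : ∀ {xs} f {x} → Unique xs → x ∈ xs → sumL xs f ≈ f x + sumL (remove x xs) f
  sumL-remove {y ∷ xs} f {x} (y∉xs ∷ !xs) x∈ with y ≟ x | x∈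
  ... | yes ≡.refl | _ = +-congˡ (reflexive (≡.cong (λ ys → sumL ys f) (≡.sym (filter-all _ xs≢x))))
    where
    xs≢x : All (λ z → ¬ z ≡ x) xs
    xs≢x = All.map (λ x≢z z≡x → x≢z (≡.sym z≡x)) y∉xs
  ... | no y≢x | here x≡y = ⊥-elim (y≢x (≡.sym x≡y))
  ... | no _ | there x∈xs = trans (+-congˡ (sumL-remove f !xs x∈xs)) (x∙yz≈y∙xz (f y) (f x) _)

  sumL-indep : ∀ xs ys f → Unique xs → Unique ys →
               (∀ {x} → x ∈ xs → x ∉ ys → f x ≈ 0#) → (∀ {y} → y ∈ ys → y ∉ xs → f y ≈ 0#) →
               sumL xs f ≈ sumL ys f
  sumL-indep []       ys f _ _ _ ys∖xs≈0 = sym (sumL-zero ys (λ y∈ → ys∖xs≈0 y∈ λ ()))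
  sumL-indep (x ∷ xs) ys f (x∉xs ∷ !xs) !ys xs∖ys≈0 ys∖xs≈0 with x ∈? ys
  ... | yes x∈ys = trans (+-congˡ rest) (sym (sumL-remove f !ys x∈ys))
    where
    rest : sumL xs f ≈ sumL (remove x ys) f
    rest = sumL-indep xs (remove x ys) f !xs (Unique.filter⁺ _ !ys)
      (λ z∈xs z∉ → xs∖ys≈0 (there z∈xs) λ z∈ys →
        z∉ (∈-filter⁺ _ z∈ys λ z≡x → All.lookup x∉xs z∈xs (≡.sym z≡x)))
      (λ z∈ z∉xs → let z∈ys , z≢x = ∈-filter⁻ _ z∈ in
        ys∖xs≈0 z∈ys λ { (here z≡x) → z≢x z≡x ; (there z∈xs) → z∉xs z∈xs })
  ... | no x∉ys = trans (+-congʳ (xs∖ys≈0 (here ≡.refl) x∉ys)) (trans (+-identityˡ _) rest)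
    where
    rest : sumL xs f ≈ sumL ys f
    rest = sumL-indep xs ys f !xs !ys (xs∖ys≈0 ∘ there)
      (λ y∈ys y∉ → ys∖xs≈0 y∈ys λ { (here ≡.refl) → x∉ys y∈ys ; (there y∈xs) → y∉ y∈xs })

module Series {c ℓ : Level} (E : Field c ℓ) where
  open Field E
  open Puiseux E
  open ListSum commutativeRing ℚ._≟_
  open RingProperties ring using (-0#≈0#; x∙y⁻¹≈ε⇒x≈y; x≈y⇒x∙y⁻¹≈ε; [y-z]x≈yx-zx; //-rightDividesˡ)
  open ℚ-Arithmetic
  open import Relation.Binary.Reasoning.Setoid setoid hiding (start)

  x≈0⇒x*y≈0 : ∀ {x y} → x ≈ 0# → x * y ≈ 0#
  x≈0⇒x*y≈0 {y = y} x≈0 = trans (*-congʳ x≈0) (zeroˡ y)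

  y≈0⇒x*y≈0 : ∀ {x y} → y ≈ 0# → x * y ≈ 0#
  y≈0⇒x*y≈0 {x} y≈0 = trans (*-congˡ y≈0) (zeroʳ x)

  x*y≈0⇒x≈0 : ∀ {x y} → ¬ y ≈ 0# → x * y ≈ 0# → x ≈ 0#
  x*y≈0⇒x≈0 {x} {y} y≉0 xy≈0 = begin
    x                ≈⟨ *-identityʳ x ⟨
    x * 1#           ≈⟨ *-congˡ y*y⁻¹≈1 ⟨
    x * (y * y⁻¹)    ≈⟨ *-assoc x y y⁻¹ ⟨
    (x * y) * y⁻¹    ≈⟨ x≈0⇒x*y≈0 xy≈0 ⟩
    0#               ∎
    where
    y⁻¹ = proj₁ (inv y y≉0)
    y*y⁻¹≈1 = proj₂ (inv y y≉0)

  x-y≈0⇒x≈y : ∀ {x y} → x - y ≈ 0# → x ≈ y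
  x-y≈0⇒x≈y = x∙y⁻¹≈ε⇒x≈y _ _

  oneCoeff-0 : oneCoeff 0ℚ ≡ 1#
  oneCoeff-0 with 0ℚ ℚ.≟ 0ℚ
  ... | yes _   = ≡.refl
  ... | no 0≢0 = ⊥-elim (0≢0 ≡.refl)

  oneCoeff-≢0 : ∀ {q} → q ≢ 0ℚ → oneCoeff q ≡ 0#
  oneCoeff-≢0 {q} q≢0 with q ℚ.≟ 0ℚ
  ... | yes q≡0 = ⊥-elim (q≢0 q≡0)
  ... | no _    = ≡.refl

  term : Ser → Ser → ℚ → ℚ → Carrier
  term x y q r = coeff x r * coeff y (q ℚ.- r)

  ν≥[_]_ : Ser → ℚ → Set ℓ
  ν≥[ w ] b = ∀ q → q ℚ.< b → coeff w q ≈ 0#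

  ν[_]≡_ : Ser → ℚ → Set ℓ
  ν[ w ]≡ v = ¬ (coeff w v ≈ 0#) × ν≥[ w ] v

  Covers : List ℚ → Ser → ℚ → Set ℓ
  Covers xs w B = ∀ r → r ℚ.≤ B → r ∉ xs → coeff w r ≈ 0#

  suppList : Ser → ℚ → List ℚ
  suppList w B = deduplicate ℚ._≟_ (supp w B)

  suppList-unique : ∀ w B → Unique (suppList w B)
  suppList-unique w B = deduplicate-! (supp w B)

  suppList-covers : ∀ w B → Covers (suppList w B) w B
  suppList-covers w B r r≤B r∉ = supp-ok w B r r≤B (r∉ ∘ ∈-deduplicate⁺ ℚ._≟_)

  Covers-mono : ∀ {xs w B B′} → B′ ℚ.≤ B → Covers xs w B → Covers xs w B′
  Covers-mono B′≤B cov r r≤B′ = cov r (ℚₚ.≤-trans r≤B′ B′≤B)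

  term-off-supp : ∀ x y q {xs r} → Covers xs x (q ℚ.- low y) → r ∉ xs → term x y q r ≈ 0#
  term-off-supp x y q {r = r} cov r∉ with r ℚ.≤? (q ℚ.- low y)
  ... | yes r≤ = x≈0⇒x*y≈0 (cov r r≤ r∉)
  ... | no r≰  = y≈0⇒x*y≈0 (below-low y (q ℚ.- r) (p-q<r⇒p-r<q {q} (ℚₚ.≰⇒> r≰)))

  mulCoeff-≈-sumL : ∀ x y q {xs} → Unique xs → (∀ r → r ∉ xs → term x y q r ≈ 0#) →
                    mulCoeff x y q ≈ sumL xs (term x y q)
  mulCoeff-≈-sumL x y q {xs} !xs off = sumL-indep (suppList x B) xs (term x y q)
    (suppList-unique x B) !xs (λ {r} _ → off r) (λ _ → term-off-supp x y q (suppList-covers x B))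
    where B = q ℚ.- low y

  mulCoeff-≈0 : ∀ x y q → (∀ r → term x y q r ≈ 0#) → mulCoeff x y q ≈ 0#
  mulCoeff-≈0 x y q off = mulCoeff-≈-sumL x y q [] (λ r _ → off r)

  term-flip : ∀ x y q s → term x y q (q ℚ.- s) ≈ term y x q s
  term-flip x y q s = trans (*-comm _ _) (*-congʳ (reflexive (≡.cong (coeff y) (p-[p-q]≡q q s))))

  mulCoeff-comm : ∀ x y q → mulCoeff x y q ≈ mulCoeff y x q
  mulCoeff-comm x y q = begin
    mulCoeff x y q                         ≈⟨ mulCoeff-≈-sumL x y q !q-ys off ⟩
    sumL (map (ℚ._-_ q) ys) (term x y q)   ≡⟨ sumL-map (ℚ._-_ q) ys (term x y q) ⟩
    sumL ys (term x y q ∘ (ℚ._-_ q))       ≈⟨ sumL-cong ys (λ {s} _ → term-flip x y q s) ⟩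
    mulCoeff y x q                         ∎
    where
    B = q ℚ.- low x
    ys = suppList y B
    !q-ys : Unique (map (ℚ._-_ q) ys)
    !q-ys = Unique.map⁺ (p-q≡p-r⇒q≡r q) (suppList-unique y B)
    off : ∀ r → r ∉ map (ℚ._-_ q) ys → term x y q r ≈ 0#
    off r r∉ = trans (sym (term-flip y x q r)) (term-off-supp y x q (suppList-covers y B) (λ q-r∈ys →
      r∉ (≡.subst (_∈ map (ℚ._-_ q) ys) (p-[p-q]≡q q r) (∈-map⁺ (ℚ._-_ q) q-r∈ys))))

  mulCoeff-⊖ˡ : ∀ a b c q → mulCoeff (a ⊖ b) c q ≈ mulCoeff a c q - mulCoeff b c q
  mulCoeff-⊖ˡ a b c q = begin
    mulCoeff (a ⊖ b) c q                          ≈⟨ sumL-cong xs (λ _ → [y-z]x≈yx-zx _ _ _) ⟩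
    sumL xs (λ r → term a c q r - term b c q r)   ≈⟨ sumL-minus xs (term a c q) (term b c q) ⟩
    sumL xs (term a c q) - sumL xs (term b c q)   ≈⟨ +-cong (mulCoeff-≈-sumL a c q !xs (λ _ → term-off-supp a c q a-covered))
                                                     (-‿cong (mulCoeff-≈-sumL b c q !xs (λ _ → term-off-supp b c q b-covered))) ⟨
    mulCoeff a c q - mulCoeff b c q               ∎
    where
    B = q ℚ.- low c
    xs = suppList (a ⊖ b) B
    !xs = suppList-unique (a ⊖ b) B
    a-covered : Covers xs a B
    a-covered r r≤B r∉ = supp-ok a B r r≤B (r∉ ∘ ∈-deduplicate⁺ ℚ._≟_ ∘ ∈-++⁺ˡ)
    b-covered : Covers xs b B
    b-covered r r≤B r∉ = supp-ok b B r r≤B (r∉ ∘ ∈-deduplicate⁺ ℚ._≟_ ∘ ∈-++⁺ʳ (supp a B))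

  mulCoeff-⊖ʳ : ∀ a b c q → mulCoeff a (b ⊖ c) q ≈ mulCoeff a b q - mulCoeff a c q
  mulCoeff-⊖ʳ a b c q = begin
    mulCoeff a (b ⊖ c) q              ≈⟨ mulCoeff-comm a (b ⊖ c) q ⟩
    mulCoeff (b ⊖ c) a q              ≈⟨ mulCoeff-⊖ˡ b c a q ⟩
    mulCoeff b a q - mulCoeff c a q   ≈⟨ +-cong (mulCoeff-comm b a q) (-‿cong (mulCoeff-comm c a q)) ⟩
    mulCoeff a b q - mulCoeff a c q   ∎

  -- ℚ is not well-founded, but only the finitely many support points of w below B matter.
  support-induction : ∀ w {B} (D : ℚ → Set) →
    (∀ {p} → D p → p ℚ.≤ B) → (∀ {p s} → D p → s ℚ.< p → D s) →
    (∀ p → D p → ν≥[ w ] p → coeff w p ≈ 0#) → ∀ p → D p → coeff w p ≈ 0#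
  support-induction w {B} D D≤B D↓ w≈0 p Dp = go (suc (countBelow p xs)) p Dp (ℕₚ.n<1+n _)
    where
    open DecMembership ℚ._≟_ using (_∈?_)
    xs = supp w B
    go : ∀ n p → D p → countBelow p xs ℕ.< n → coeff w p ≈ 0#
    go (suc n) p Dp count< = w≈0 p Dp below
      where
      below : ν≥[ w ] p
      below s s<p with s ∈? xs
      ... | yes s∈ = go n s (D↓ Dp s<p) (ℕₚ.<-≤-trans (countBelow-< s∈ s<p) (ℕₚ.≤-pred count<))
      ... | no s∉  = supp-ok w B s (ℚₚ.≤-trans (ℚₚ.<⇒≤ s<p) (D≤B Dp)) s∉

  cancel-right : ∀ w x {v B} (D : ℚ → Set) → ν[ x ]≡ v →
    (∀ {p} → D p → p ℚ.≤ B) → (∀ {p s} → D p → s ℚ.< p → D s) →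
    (∀ p → D p → mulCoeff w x (p ℚ.+ v) ≈ 0#) → ∀ p → D p → coeff w p ≈ 0#
  cancel-right w x {v} D (x≉0 , x≥) D≤B D↓ wx≈0 = support-induction w D D≤B D↓ w≈0
    where
    w≈0 : ∀ p → D p → ν≥[ w ] p → coeff w p ≈ 0#
    w≈0 p Dp w≥ = x*y≈0⇒x≈0 x≉0 (begin
      coeff w p * coeff x v                ≈⟨ *-congˡ (reflexive (≡.cong (coeff x) (p+q-p≡q p v))) ⟨
      term w x q p                         ≈⟨ +-identityʳ _ ⟨
      sumL (p ∷ []) (term w x q)           ≈⟨ mulCoeff-≈-sumL w x q (All.[] ∷ []) off ⟨
      mulCoeff w x q                       ≈⟨ wx≈0 p Dp ⟩
      0#                                   ∎)
      where
      q = p ℚ.+ v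
      off : ∀ s → s ∉ p ∷ [] → term w x q s ≈ 0#
      off s s∉ with ℚₚ.<-cmp s p
      ... | tri< s<p _ _ = x≈0⇒x*y≈0 (w≥ s s<p)
      ... | tri≈ _ s≡p _ = ⊥-elim (s∉ (here s≡p))
      ... | tri> _ _ s>p = y≈0⇒x*y≈0 (x≥ (q ℚ.- s) (p<r⇒p+q-r<q s>p))

  ·≋1-comm : ∀ {y x} → y · x ≋1 → x · y ≋1
  ·≋1-comm {y} {x} yx q = trans (mulCoeff-comm x y q) (yx q)

  inverse-ν≥ : ∀ {y x v} → y · x ≋1 → ν[ x ]≡ v → ν≥[ y ] (ℚ.- v)
  inverse-ν≥ {y} {x} {v} yx x≡v =
    cancel-right y x (ℚ._< ℚ.- v) x≡v ℚₚ.<⇒≤ (λ p<-v s<p → ℚₚ.<-trans s<p p<-v)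
      (λ p p<-v → trans (yx (p ℚ.+ v)) (reflexive (oneCoeff-≢0 (ℚₚ.<⇒≢ (p<-q⇒p+q<0 p<-v)))))

  inverse-ν≡ : ∀ {y x d} → y · x ≋1 → ν[ y ]≡ (ℚ.- d) → ν[ x ]≡ d
  inverse-ν≡ {y} {x} {d} yx y≡-d@(y≉0 , y≥) = x≉0 , x≥
    where
    x≥ : ν≥[ x ] d
    x≥ = ≡.subst (ν≥[ x ]_) (neg-involutive d) (inverse-ν≥ {x} {y} (·≋1-comm {y} {x} yx) y≡-d)
    x≉0 : ¬ coeff x d ≈ 0#
    x≉0 x≈0 = 0≉1 (begin
      0#                ≈⟨ mulCoeff-≈0 y x 0ℚ off ⟨
      mulCoeff y x 0ℚ   ≈⟨ yx 0ℚ ⟩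
      oneCoeff 0ℚ       ≡⟨ oneCoeff-0 ⟩
      1#                ∎)
      where
      off : ∀ s → term y x 0ℚ s ≈ 0#
      off s with ℚₚ.<-cmp s (ℚ.- d)
      ... | tri< s<-d _ _    = x≈0⇒x*y≈0 (y≥ s s<-d)
      ... | tri≈ _ ≡.refl _ = y≈0⇒x*y≈0 (trans (reflexive (≡.cong (coeff x) (0-[-p]≡p d))) x≈0)
      ... | tri> _ _ s>-d    = y≈0⇒x*y≈0 (x≥ (0ℚ ℚ.- s) (-p<q⇒0-q<p s>-d))

  ν>⇒≈ : ∀ x x′ {C q} → ν>[ x ⊖ x′ ] C → q ℚ.≤ C → coeff x q ≈ coeff x′ q
  ν>⇒≈ x x′ close q≤C = x-y≈0⇒x≈y (close _ q≤C)

  ν>-sym : ∀ x x′ {C} → ν>[ x ⊖ x′ ] C → ν>[ x′ ⊖ x ] C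
  ν>-sym x x′ close q q≤C = x≈y⇒x∙y⁻¹≈ε (sym (ν>⇒≈ x x′ close q≤C))

  ν≡-of-ν> : ∀ {x x′ d C} → ν[ x ]≡ d → d ℚ.≤ C → ν>[ x ⊖ x′ ] C → ν[ x′ ]≡ d
  ν≡-of-ν> {x} {x′} (x≉0 , x≥) d≤C close =
    (λ x′≈0 → x≉0 (trans (ν>⇒≈ x x′ close d≤C) x′≈0)) ,
    (λ q q<d → trans (sym (ν>⇒≈ x x′ close (ℚₚ.≤-trans (ℚₚ.<⇒≤ q<d) d≤C))) (x≥ q q<d))

  inverse-ν> : ∀ {y x y′ x′ d C} → y · x ≋1 → y′ · x′ ≋1 → ν[ x ]≡ d → ν[ x′ ]≡ d →
               ν>[ x ⊖ x′ ] C → ν>[ y ⊖ y′ ] ((C ℚ.- d) ℚ.- d)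
  inverse-ν> {y} {x} {y′} {x′} {d} {C} yx y′x′ x≡d x′≡d close =
    cancel-right (y ⊖ y′) x (ℚ._≤ C′) x≡d id (λ p≤C′ s<p → ℚₚ.≤-trans (ℚₚ.<⇒≤ s<p) p≤C′) diff≈0
    where
    -- (y - y′) x = y′ (x′ - x), since y x = 1 = y′ x′
    C′ = (C ℚ.- d) ℚ.- d
    diff≈0 : ∀ p → p ℚ.≤ C′ → mulCoeff (y ⊖ y′) x (p ℚ.+ d) ≈ 0#
    diff≈0 p p≤C′ = begin
      mulCoeff (y ⊖ y′) x q              ≈⟨ mulCoeff-⊖ˡ y y′ x q ⟩
      mulCoeff y x q - mulCoeff y′ x q   ≈⟨ +-congʳ (trans (yx q) (sym (y′x′ q))) ⟩
      mulCoeff y′ x′ q - mulCoeff y′ x q ≈⟨ mulCoeff-⊖ʳ y′ x′ x q ⟨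
      mulCoeff y′ (x′ ⊖ x) q             ≈⟨ mulCoeff-≈0 y′ (x′ ⊖ x) q off ⟩
      0#                                 ∎
      where
      q = p ℚ.+ d
      off : ∀ s → term y′ (x′ ⊖ x) q s ≈ 0#
      off s with s ℚ.<? ℚ.- d
      ... | yes s<-d = x≈0⇒x*y≈0 (inverse-ν≥ {y′} {x′} y′x′ x′≡d s s<-d)
      ... | no s≮-d  = y≈0⇒x*y≈0
        (ν>-sym x x′ close (q ℚ.- s) (p≤[r-q]-q⇒-q≤s⇒p+q-s≤r p≤C′ (ℚₚ.≮⇒≥ s≮-d)))

  polar-≤0 : ∀ w {q} → q ℚ.≤ 0ℚ → coeff (polar w) q ≡ coeff w q
  polar-≤0 w {q} q≤0 with q ℚ.≤? 0ℚ
  ... | yes _  = ≡.refl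
  ... | no q≰0 = ⊥-elim (q≰0 q≤0)

  polar->0 : ∀ w {q} → ¬ q ℚ.≤ 0ℚ → coeff (polar w) q ≡ 0#
  polar->0 w {q} q≰0 with q ℚ.≤? 0ℚ
  ... | yes q≤0 = ⊥-elim (q≰0 q≤0)
  ... | no _    = ≡.refl

  polar-≋-of-ν> : ∀ {w w′ C} → 0ℚ ℚ.≤ C → ν>[ w ⊖ w′ ] C → polar w ≋ polar w′
  polar-≋-of-ν> {w} {w′} 0≤C close q = by-sign (q ℚ.≤? 0ℚ)
    where
    by-sign : Dec (q ℚ.≤ 0ℚ) → coeff (polar w) q ≈ coeff (polar w′) q
    by-sign (yes q≤0) = begin
      coeff (polar w) q    ≡⟨ polar-≤0 w q≤0 ⟩
      coeff w q            ≈⟨ ν>⇒≈ w w′ close (ℚₚ.≤-trans q≤0 0≤C) ⟩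
      coeff w′ q           ≡⟨ polar-≤0 w′ q≤0 ⟨
      coeff (polar w′) q   ∎
    by-sign (no q≰0) = reflexive (≡.trans (polar->0 w q≰0) (≡.sym (polar->0 w′ q≰0)))

  frac : Ser → Ser
  frac w = w ⊖ polar w

  frac-≤0 : ∀ w {q} → q ℚ.≤ 0ℚ → coeff (frac w) q ≈ 0#
  frac-≤0 w q≤0 = x≈y⇒x∙y⁻¹≈ε (sym (reflexive (polar-≤0 w q≤0)))

  frac->0 : ∀ w {q} → ¬ q ℚ.≤ 0ℚ → coeff (frac w) q ≈ coeff w q
  frac->0 w q≰0 = trans (+-congˡ (trans (-‿cong (reflexive (polar->0 w q≰0))) -0#≈0#)) (+-identityʳ _)

  ν>-frac : ∀ {w w′ C} → ν>[ w ⊖ w′ ] C → ν>[ frac w ⊖ frac w′ ] C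
  ν>-frac {w} {w′} close q q≤C = by-sign (q ℚ.≤? 0ℚ)
    where
    by-sign : Dec (q ℚ.≤ 0ℚ) → coeff (frac w ⊖ frac w′) q ≈ 0#
    by-sign (yes q≤0) = x≈y⇒x∙y⁻¹≈ε (trans (frac-≤0 w q≤0) (sym (frac-≤0 w′ q≤0)))
    by-sign (no q≰0)  = trans (+-cong (frac->0 w q≰0) (-‿cong (frac->0 w′ q≰0))) (close q q≤C)

  IsDeg-polar⇒-d≤0 : ∀ {w d} → IsDeg (polar w) d → ℚ.- d ℚ.≤ 0ℚ
  IsDeg-polar⇒-d≤0 {w} {d} (f≉0 , _) = decidable-stable (ℚ.- d ℚ.≤? 0ℚ)
    (λ -d≰0 → f≉0 (reflexive (polar->0 w -d≰0)))

  IsDeg-polar⇒ν≡ : ∀ {w d} → IsDeg (polar w) d → ν[ w ]≡ (ℚ.- d)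
  IsDeg-polar⇒ν≡ {w} {d} deg@(f≉0 , f≥) =
    (λ w≈0 → f≉0 (trans (reflexive (polar-≤0 w -d≤0)) w≈0)) ,
    (λ q q<-d → trans (sym (reflexive (polar-≤0 w (ℚₚ.≤-trans (ℚₚ.<⇒≤ q<-d) -d≤0)))) (f≥ q q<-d))
    where -d≤0 = IsDeg-polar⇒-d≤0 {w} deg

  module Inverse (x : Ser) (v : ℚ) (x≡v : ν[ x ]≡ v) where
    open DecMembership ℚ._≟_ using (_∈?_)

    a : Carrier
    a = coeff x v

    a⁻¹ : Carrier
    a⁻¹ = proj₁ (inv a (proj₁ x≡v))

    a*[a⁻¹*t]≈t : ∀ t → a * (a⁻¹ * t) ≈ t
    a*[a⁻¹*t]≈t t = begin
      a * (a⁻¹ * t)   ≈⟨ *-assoc a a⁻¹ t ⟨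
      (a * a⁻¹) * t   ≈⟨ *-congʳ (proj₂ (inv a (proj₁ x≡v))) ⟩
      1# * t          ≈⟨ *-identityˡ t ⟩
      t               ∎

    gaps : List ℚ → List ℚ
    gaps = filter (v ℚ.<?_)

    tailSum : List ℚ → (ℚ → Carrier) → ℚ → Carrier
    tailSum xs g q = sumL (gaps xs) (λ r → coeff x r * g (q ℚ.- r))

    -- Comparing coefficients of t^-(p+v) in y·x = 1 gives
    -- a y_p + Σ_{r > v} x_r y_{p+v-r} = δ_{p+v}; Y iterates this n times,
    -- reading the exponents of x off xs.
    Y : List ℚ → ℕ → ℚ → Carrier
    Y xs zero    p = 0#
    Y xs (suc n) p with p ℚ.<? ℚ.- v
    ... | yes _ = 0#
    ... | no _  = a⁻¹ * (oneCoeff (p ℚ.+ v) - tailSum xs (Y xs n) (p ℚ.+ v))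

    VanishesBelow : (ℚ → Carrier) → Set ℓ
    VanishesBelow g = ∀ s → s ℚ.< ℚ.- v → g s ≈ 0#

    Y-below : ∀ xs n → VanishesBelow (Y xs n)
    Y-below xs zero    s _ = refl
    Y-below xs (suc n) s s<-v with s ℚ.<? ℚ.- v
    ... | yes _   = refl
    ... | no s≮-v = ⊥-elim (s≮-v s<-v)

    Y-unfold : ∀ xs n {p} → ¬ p ℚ.< ℚ.- v →
               Y xs (suc n) p ≡ a⁻¹ * (oneCoeff (p ℚ.+ v) - tailSum xs (Y xs n) (p ℚ.+ v))
    Y-unfold xs n {p} p≮-v with p ℚ.<? ℚ.- v
    ... | yes p<-v = ⊥-elim (p≮-v p<-v)
    ... | no _     = ≡.refl

    tail-term-zero : ∀ {g xs} q {r} → VanishesBelow g → Covers xs x (q ℚ.+ v) → r ∉ xs →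
                     coeff x r * g (q ℚ.- r) ≈ 0#
    tail-term-zero {g} {xs} q {r} g↓ cov r∉ with (q ℚ.- r) ℚ.<? ℚ.- v
    ... | yes below = y≈0⇒x*y≈0 (g↓ _ below)
    ... | no ¬below = x≈0⇒x*y≈0 (cov r (-q≤p-r⇒r≤p+q {q} (ℚₚ.≮⇒≥ ¬below)) r∉)

    ∈-gaps⇒< : ∀ xs {r} → r ∈ gaps xs → v ℚ.< r
    ∈-gaps⇒< xs r∈ = proj₂ (∈-filter⁻ (v ℚ.<?_) {xs = xs} r∈)

    ∈-gaps⁺ : ∀ {xs r} → r ∈ xs → v ℚ.< r → r ∈ gaps xs
    ∈-gaps⁺ = ∈-filter⁺ (v ℚ.<?_)

    tailSum-indep : ∀ {g xs₁ xs₂} q → VanishesBelow g → Unique xs₁ → Unique xs₂ →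
                    Covers xs₁ x (q ℚ.+ v) → Covers xs₂ x (q ℚ.+ v) → tailSum xs₁ g q ≈ tailSum xs₂ g q
    tailSum-indep {g} {xs₁} {xs₂} q g↓ !xs₁ !xs₂ cov₁ cov₂ =
      sumL-indep (gaps xs₁) (gaps xs₂) _ (Unique.filter⁺ _ !xs₁) (Unique.filter⁺ _ !xs₂)
        (λ r∈₁ r∉₂ → tail-term-zero q g↓ cov₂ (λ r∈xs₂ → r∉₂ (∈-gaps⁺ r∈xs₂ (∈-gaps⇒< xs₁ r∈₁))))
        (λ r∈₂ r∉₁ → tail-term-zero q g↓ cov₁ (λ r∈xs₁ → r∉₁ (∈-gaps⁺ r∈xs₁ (∈-gaps⇒< xs₂ r∈₂))))

    ε : List ℚ → ℚ
    ε xs = min 1ℚ (map (λ r → r ℚ.- v) (gaps xs))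

    ε-pos : ∀ xs → 0ℚ ℚ.< ε xs
    ε-pos xs = argmin-all id {P = 0ℚ ℚ.<_} (ℚₚ.positive⁻¹ 1ℚ)
      (All.map⁺ (All.tabulate (p<q⇒0<q-p ∘ ∈-gaps⇒< xs)))

    ε-≤ : ∀ xs {r} → r ∈ gaps xs → ε xs ℚ.≤ r ℚ.- v
    ε-≤ xs r∈ = All.lookup (min≤xs 1ℚ _) (∈-map⁺ (λ r → r ℚ.- v) r∈)

    -- Each step of the recursion lowers p + v by at least ε xs.
    Enough : List ℚ → ℕ → ℚ → Set
    Enough xs n p = p ℚ.+ v ℚ.< n ⋆ ε xs

    Enough-zero : ∀ {xs p} → Enough xs 0 p → p ℚ.< ℚ.- v
    Enough-zero = p+q<0⇒p<-q

    Enough-step : ∀ {xs n p r} → Enough xs (suc n) p → r ∈ gaps xs → Enough xs n ((p ℚ.+ v) ℚ.- r)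
    Enough-step {xs} en r∈ = e≤r-q⇒p<e+n⇒p-r+q<n (ε-≤ xs r∈) en

    Y-indep : ∀ {xs₁ xs₂} n₁ n₂ p → Unique xs₁ → Unique xs₂ →
              Covers xs₁ x ((p ℚ.+ v) ℚ.+ v) → Covers xs₂ x ((p ℚ.+ v) ℚ.+ v) →
              Enough xs₁ n₁ p → Enough xs₂ n₂ p → Y xs₁ n₁ p ≈ Y xs₂ n₂ p
    Y-indep {xs₁} {xs₂} zero n₂ p _ _ _ _ en₁ _ = sym (Y-below xs₂ n₂ p (Enough-zero {xs₁} en₁))
    Y-indep {xs₁} {xs₂} (suc n₁) zero p _ _ _ _ _ en₂ = Y-below xs₁ (suc n₁) p (Enough-zero {xs₂} en₂)
    Y-indep {xs₁} {xs₂} (suc n₁) (suc n₂) p !xs₁ !xs₂ cov₁ cov₂ en₁ en₂ with p ℚ.<? ℚ.- v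
    ... | yes _ = refl
    ... | no _  = *-congˡ (+-congˡ (-‿cong tails≈))
      where
      q = p ℚ.+ v
      termwise : ∀ {r} → r ∈ gaps xs₁ → coeff x r * Y xs₁ n₁ (q ℚ.- r) ≈ coeff x r * Y xs₂ n₂ (q ℚ.- r)
      termwise {r} r∈ with r ∈? xs₂
      ... | no r∉xs₂  = trans (tail-term-zero q (Y-below xs₁ n₁) cov₂ r∉xs₂)
                              (sym (tail-term-zero q (Y-below xs₂ n₂) cov₂ r∉xs₂))
      ... | yes r∈xs₂ = *-congˡ (Y-indep n₁ n₂ (q ℚ.- r) !xs₁ !xs₂
                          (Covers-mono {xs₁} {x} shrink cov₁) (Covers-mono {xs₂} {x} shrink cov₂)
                          (Enough-step {xs₁} {n₁} {p} en₁ r∈)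
                          (Enough-step {xs₂} {n₂} {p} en₂ (∈-gaps⁺ r∈xs₂ (∈-gaps⇒< xs₁ r∈))))
        where shrink = q<r⇒p+q-r+q+q≤p+q+q {p} (∈-gaps⇒< xs₁ r∈)
      tails≈ : tailSum xs₁ (Y xs₁ n₁) q ≈ tailSum xs₂ (Y xs₂ n₂) q
      tails≈ = trans (sumL-cong (gaps xs₁) termwise) (tailSum-indep q (Y-below xs₂ n₂) !xs₁ !xs₂ cov₁ cov₂)

    listFor : ℚ → List ℚ
    listFor p = suppList x ((p ℚ.+ v) ℚ.+ v)

    -- Opaque, so that unification never evaluates the archimedean witness.
    opaque
      fuelFor : ℚ → ℕ
      fuelFor p = proj₁ (archimedean (p ℚ.+ v) (ε (listFor p)) (ε-pos (listFor p)))

      fuelFor-enough : ∀ p → Enough (listFor p) (fuelFor p) p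
      fuelFor-enough p = proj₂ (archimedean (p ℚ.+ v) (ε (listFor p)) (ε-pos (listFor p)))

    y-coeff : ℚ → Carrier
    y-coeff p = Y (listFor p) (fuelFor p) p

    y-below : VanishesBelow y-coeff
    y-below s = Y-below (listFor s) (fuelFor s) s

    Y≈y-coeff : ∀ {xs n} p → Unique xs → Covers xs x ((p ℚ.+ v) ℚ.+ v) → Enough xs n p → Y xs n p ≈ y-coeff p
    Y≈y-coeff {n = n} p !xs cov en =
      Y-indep n (fuelFor p) p !xs (suppList-unique x _) cov (suppList-covers x _) en (fuelFor-enough p)

    y-recurrence : ∀ {p xs} → ¬ p ℚ.< ℚ.- v → Unique xs → Covers xs x ((p ℚ.+ v) ℚ.+ v) →
                   a * y-coeff p + tailSum xs y-coeff (p ℚ.+ v) ≈ oneCoeff (p ℚ.+ v)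
    y-recurrence {p} {xs} p≮-v !xs cov = from-fuel (fuelFor p) (fuelFor-enough p)
      where
      L = listFor p
      q = p ℚ.+ v
      δ = oneCoeff q
      T = tailSum xs y-coeff q
      from-fuel : ∀ n → Enough L n p → a * Y L n p + T ≈ δ
      from-fuel zero    en = ⊥-elim (p≮-v (Enough-zero {L} en))
      from-fuel (suc n) en = begin
        a * Y L (suc n) p + T                        ≡⟨ ≡.cong (λ t → a * t + T) (Y-unfold L n p≮-v) ⟩
        a * (a⁻¹ * (δ - tailSum L (Y L n) q)) + T    ≈⟨ +-congʳ (a*[a⁻¹*t]≈t _) ⟩
        (δ - tailSum L (Y L n) q) + T                ≈⟨ +-congʳ (+-congˡ (-‿cong tails≈)) ⟩
        (δ - T) + T                                  ≈⟨ //-rightDividesˡ T δ ⟩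
        δ                                            ∎
        where
        termwise : ∀ {r} → r ∈ gaps L → coeff x r * Y L n (q ℚ.- r) ≈ coeff x r * y-coeff (q ℚ.- r)
        termwise {r} r∈ = *-congˡ (Y≈y-coeff {L} {n} (q ℚ.- r) (suppList-unique x _)
          (Covers-mono {L} {x} (q<r⇒p+q-r+q+q≤p+q+q {p} (∈-gaps⇒< L r∈)) (suppList-covers x _))
          (Enough-step {L} {n} {p} en r∈))
        tails≈ : tailSum L (Y L n) q ≈ T
        tails≈ = trans (sumL-cong (gaps L) termwise)
          (tailSum-indep q y-below (suppList-unique x _) !xs (suppList-covers x _) cov)

    reach : List ℚ → ℕ → List ℚ
    reach xs zero    = []
    reach xs (suc n) = ℚ.- v ∷ cartesianProductWith (λ s r → s ℚ.+ (r ℚ.- v)) (reach xs n) (gaps xs)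

    Y-supported : ∀ xs n {p} → p ∉ reach xs n → Y xs n p ≈ 0#
    Y-supported xs zero    _ = refl
    Y-supported xs (suc n) {p} p∉ with p ℚ.<? ℚ.- v
    ... | yes _ = refl
    ... | no _  = begin
      a⁻¹ * (oneCoeff q - tailSum xs (Y xs n) q) ≈⟨ *-congˡ (+-cong (reflexive (oneCoeff-≢0 q≢0))
                                                                     (-‿cong tail≈0)) ⟩
      a⁻¹ * (0# - 0#)                            ≈⟨ *-congˡ (-‿inverseʳ 0#) ⟩
      a⁻¹ * 0#                                   ≈⟨ zeroʳ a⁻¹ ⟩
      0#                                         ∎
      where
      q = p ℚ.+ v
      q≢0 : q ≢ 0ℚ
      q≢0 q≡0 = p∉ (here (p+q≡0⇒p≡-q q≡0))
      tail≈0 : tailSum xs (Y xs n) q ≈ 0#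
      tail≈0 = sumL-zero (gaps xs) λ {r} r∈ → y≈0⇒x*y≈0 (Y-supported xs n λ q-r∈ →
        p∉ (there (≡.subst (_∈ _) (p+q-r+[r-q]≡p p v r)
          (∈-cartesianProductWith⁺ (λ s r → s ℚ.+ (r ℚ.- v)) q-r∈ r∈))))

    y-supported : ∀ B p → p ℚ.≤ B → p ∉ reach (listFor B) (fuelFor B) → y-coeff p ≈ 0#
    y-supported B p p≤B p∉ = trans (sym (Y≈y-coeff {L} {n} p (suppList-unique x _) cov en)) (Y-supported L n p∉)
      where
      L = listFor B
      n = fuelFor B
      cov : Covers L x ((p ℚ.+ v) ℚ.+ v)
      cov = Covers-mono {L} {x} (ℚₚ.+-monoˡ-≤ v (ℚₚ.+-monoˡ-≤ v p≤B)) (suppList-covers x _)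
      en : Enough L n p
      en = ℚₚ.≤-<-trans (ℚₚ.+-monoˡ-≤ v p≤B) (fuelFor-enough B)

    y : Ser
    y = record
      { coeff     = y-coeff
      ; low       = ℚ.- v
      ; below-low = y-below
      ; supp      = λ B → reach (listFor B) (fuelFor B)
      ; supp-ok   = y-supported
      }

    y·x≋1 : y · x ≋1
    y·x≋1 q = trans (mulCoeff-comm y x q) (by-sign (q ℚ.<? 0ℚ))
      where
      by-sign : Dec (q ℚ.< 0ℚ) → mulCoeff x y q ≈ oneCoeff q
      by-sign (yes q<0) = trans (mulCoeff-≈0 x y q off) (sym (reflexive (oneCoeff-≢0 (ℚₚ.<⇒≢ q<0))))
        where
        off : ∀ r → term x y q r ≈ 0#
        off r with r ℚ.<? v
        ... | yes r<v = x≈0⇒x*y≈0 (proj₂ x≡v r r<v)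
        ... | no r≮v  = y≈0⇒x*y≈0 (y-below (q ℚ.- r) (p<0⇒q≤r⇒p-r<-q q<0 (ℚₚ.≮⇒≥ r≮v)))
      by-sign (no q≮0) = begin
        mulCoeff x y q                                  ≈⟨ mulCoeff-≈-sumL x y q !list off ⟩
        a * y-coeff (q ℚ.- v) + tailSum xs y-coeff q    ≈⟨ ≡.subst recurrence-at (p-q+q≡p q v)
                                                               (y-recurrence p≮-v !xs cov) ⟩
        oneCoeff q                                      ∎
        where
        xs = suppList x (q ℚ.+ v)
        !xs = suppList-unique x (q ℚ.+ v)
        recurrence-at : ℚ → Set ℓ
        recurrence-at t = a * y-coeff (q ℚ.- v) + tailSum xs y-coeff t ≈ oneCoeff t
        p≮-v : ¬ q ℚ.- v ℚ.< ℚ.- v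
        p≮-v p<-v = ℚₚ.<-irrefl ≡.refl (ℚₚ.<-≤-trans p<-v (0≤p⇒-q≤p-q (ℚₚ.≮⇒≥ q≮0)))
        cov : Covers xs x (((q ℚ.- v) ℚ.+ v) ℚ.+ v)
        cov = ≡.subst (λ t → Covers xs x (t ℚ.+ v)) (≡.sym (p-q+q≡p q v)) (suppList-covers x (q ℚ.+ v))
        !list : Unique (v ∷ gaps xs)
        !list = All.tabulate (λ r∈ → ℚₚ.<⇒≢ (∈-gaps⇒< xs r∈)) ∷ Unique.filter⁺ (v ℚ.<?_) !xs
        off : ∀ r → r ∉ v ∷ gaps xs → term x y q r ≈ 0#
        off r r∉ with ℚₚ.<-cmp r v
        ... | tri< r<v _ _ = x≈0⇒x*y≈0 (proj₂ x≡v r r<v)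
        ... | tri≈ _ r≡v _ = ⊥-elim (r∉ (here r≡v))
        ... | tri> _ _ v<r = tail-term-zero {y-coeff} q y-below (suppList-covers x _)
                               (λ r∈xs → r∉ (there (∈-gaps⁺ r∈xs v<r)))

  invert : ∀ {x v} → ν[ x ]≡ v → Σ Ser (λ y → y · x ≋1)
  invert {x} {v} x≡v = Inverse.y x v x≡v , Inverse.y·x≋1 x v x≡v

  sum1to-mono : ∀ ds {i n} → (∀ j → 1 ℕ.≤ j → j ℕ.≤ n → 0ℚ ℚ.≤ ds j) → i ℕ.≤ n →
                sum1to ds i ℚ.≤ sum1to ds n
  sum1to-mono ds {n = zero}  _    z≤n  = ℚₚ.≤-refl
  sum1to-mono ds {i} {suc n} ds≥0 i≤1+n with i ℕ.≤? n
  ... | yes i≤n = ℚₚ.≤-trans (sum1to-mono ds (λ j 1≤j j≤n → ds≥0 j 1≤j (ℕₚ.m≤n⇒m≤1+n j≤n)) i≤n)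
                             (0≤q⇒p≤p+q (ds≥0 (suc n) (s≤s z≤n) ℕₚ.≤-refl))
  ... | no i≰n rewrite ℕₚ.≤-antisym i≤1+n (ℕₚ.≰⇒> i≰n) = ℚₚ.≤-refl

  cf-extend : ∀ {w k} (d : CFUpTo w k) (y : Ser) → y · frac (zs d k) ≋1 → CFUpTo w (suc k)
  cf-extend {w} {k} d y y·fₖ≋1 = record { zs = zs′ ; start = start d ; step = step′ }
    where
    zs′ : ℕ → Ser
    zs′ i with i ℕ.≤? k
    ... | yes _ = zs d i
    ... | no _  = y
    step′ : ∀ i → i ℕ.< suc k → zs′ (suc i) · (zs′ i ⊖ polar (zs′ i)) ≋1
    step′ i (s≤s i≤k) with suc i ℕ.≤? k | i ℕ.≤? k
    ... | yes i<k | yes _ = step d i i<k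
    ... | no i≮k  | yes _ rewrite ℕₚ.≤-antisym i≤k (ℕₚ.≮⇒≥ i≮k) = y·fₖ≋1
    ... | _       | no i≰k = ⊥-elim (i≰k i≤k)

  module Agreement (z z′ : Ser) (m : ℕ) (d : CFUpTo z m) (ds : ℕ → ℚ)
    (deg : ∀ i → 1 ℕ.≤ i → i ℕ.≤ m → IsDeg (fq d i) (ds i))
    (close₀ : ν>[ z ⊖ z′ ] (sum1to ds m ℚ.+ sum1to ds m)) where

    σ : ℕ → ℚ
    σ = sum1to ds

    budget : ℕ → ℚ
    budget i = (σ m ℚ.- σ i) ℚ.+ (σ m ℚ.- σ i)

    ds-nonNeg : ∀ j → 1 ℕ.≤ j → j ℕ.≤ m → 0ℚ ℚ.≤ ds j
    ds-nonNeg j 1≤j j≤m = -p≤0⇒0≤p (IsDeg-polar⇒-d≤0 {zs d j} (deg j 1≤j j≤m))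

    budget-zero : budget 0 ≡ σ m ℚ.+ σ m
    budget-zero = ≡.cong₂ ℚ._+_ (ℚₚ.+-identityʳ (σ m)) (ℚₚ.+-identityʳ (σ m))

    budget-suc : ∀ i → budget (suc i) ≡ (budget i ℚ.- ds (suc i)) ℚ.- ds (suc i)
    budget-suc i = [r-[p+q]]+[r-[p+q]]≡[r-p]+[r-p]-q-q (σ i) (ds (suc i)) (σ m)

    budget-nonNeg : ∀ {i} → i ℕ.≤ m → 0ℚ ℚ.≤ budget i
    budget-nonNeg i≤m = p≤q⇒0≤[q-p]+[q-p] (sum1to-mono ds ds-nonNeg i≤m)

    ds≤budget : ∀ j → suc j ℕ.≤ m → ds (suc j) ℚ.≤ budget j
    ds≤budget j sj≤m = 0≤[p-q]-q⇒0≤q⇒q≤p (≡.subst (0ℚ ℚ.≤_) (budget-suc j) (budget-nonNeg sj≤m))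
                                          (ds-nonNeg (suc j) (s≤s z≤n) sj≤m)

    frac-ν≡ : ∀ j → suc j ℕ.≤ m → ν[ frac (zs d j) ]≡ ds (suc j)
    frac-ν≡ j sj≤m = inverse-ν≡ {zs d (suc j)} {frac (zs d j)} (step d j sj≤m)
                                (IsDeg-polar⇒ν≡ {zs d (suc j)} (deg (suc j) (s≤s z≤n) sj≤m))

    close : ∀ {k} (d′ : CFUpTo z′ k) → k ℕ.≤ m → ∀ i → i ℕ.≤ k → ν>[ zs d i ⊖ zs d′ i ] (budget i)
    frac′-ν≡ : ∀ {k} (d′ : CFUpTo z′ k) → k ℕ.≤ m → ∀ j → j ℕ.≤ k → suc j ℕ.≤ m →
               ν[ frac (zs d′ j) ]≡ ds (suc j)

    close d′ _ zero _ q q≤ =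
      trans (+-cong (start d q) (-‿cong (start d′ q))) (close₀ q (≡.subst (q ℚ.≤_) budget-zero q≤))
    close d′ k≤m (suc j) sj≤k = ≡.subst (ν>[ zs d (suc j) ⊖ zs d′ (suc j) ]_) (≡.sym (budget-suc j))
      (inverse-ν> {zs d (suc j)} {frac (zs d j)} {zs d′ (suc j)} {frac (zs d′ j)}
        (step d j sj≤m) (step d′ j sj≤k) (frac-ν≡ j sj≤m) (frac′-ν≡ d′ k≤m j j≤k sj≤m)
        (ν>-frac {zs d j} {zs d′ j} (close d′ k≤m j j≤k)))
      where
      j≤k = ℕₚ.<⇒≤ sj≤k
      sj≤m = ℕₚ.≤-trans sj≤k k≤m

    frac′-ν≡ d′ k≤m j j≤k sj≤m = ν≡-of-ν> {frac (zs d j)} {frac (zs d′ j)} (frac-ν≡ j sj≤m) (ds≤budget j sj≤m)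
                                   (ν>-frac {zs d j} {zs d′ j} (close d′ k≤m j j≤k))

    build : ∀ k → k ℕ.≤ m → CFUpTo z′ k
    build zero    _    = record { zs = λ _ → z′ ; start = λ _ → refl ; step = λ _ () }
    build (suc k) sk≤m = cf-extend d′ (proj₁ inverse) (proj₂ inverse)
      where
      k≤m = ℕₚ.<⇒≤ sk≤m
      d′ = build k k≤m
      inverse = invert {frac (zs d′ k)} (frac′-ν≡ d′ k≤m k ℕₚ.≤-refl sk≤m)

open import Data.Nat using (_≤_)
open import Data.Rational using (_+_)

lemma4p1 : ∀ {c ℓ : Level} (E : Field c ℓ) → let open Puiseux E in
    (z z' : Ser) (m : ℕ) (d : CFUpTo z m) (ds : ℕ → ℚ) →
    (∀ i → 1 ≤ i → i ≤ m → IsDeg (fq d i) (ds i)) →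
    ν>[ z ⊖ z' ] (sum1to ds m + sum1to ds m) →
    CFUpTo z' m × (∀ (d' : CFUpTo z' m) → ∀ i → i ≤ m → fq d i ≋ fq d' i)
lemma4p1 E z z′ m d ds deg close₀ =
  build m ℕₚ.≤-refl , λ d′ i i≤m →
    polar-≋-of-ν> {zs d i} {zs d′ i} (budget-nonNeg i≤m) (close d′ ℕₚ.≤-refl i i≤m)
  where
  open Puiseux E using (zs)
  open Series E using (polar-≋-of-ν>)
  open Series.Agreement E z z′ m d ds deg close₀
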